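{- Let $U$ be a countably infinite set and $\mathrm{G}$ an algebraically finite subgroup of $\mathfrak{S}(U)$. Then $\mathfrak{rc}(S)=\mathfrak{ac}(S)$ for every subset $S$ of $U$.
   Context: For $F\subseteq U$, $\mathrm{G}\langle F\rangle=\{g\in\mathrm{G}\mid g(x)=x\ \forall x\in F\}$. For finite $F$, $\mathfrak{ac}(F)$ is the union of all finite orbits of $\mathrm{G}\langle F\rangle$ acting on $U$; for arbitrary $S$, $\mathfrak{ac}(S)=\bigcup\{\mathfrak{ac}(F)\mid F \text{ finite}\subseteq S\}$. $\mathrm{G}$ is algebraically finite if $\mathfrak{ac}(F)$ is finite for all finite $F$. A type is a pair $\langle F\mid p\rangle$ with $F$ finite, $p\in U$, with typeset $\mathrm{G}\langle F\mid p\rangle=\{g(p)\mid g\in\mathrm{G}\langle F\rangle\}$; $\mathfrak{R}_0$ is the set of types with finite typeset; $\langle F\mid p\rangle\in\mathfrak{R}_\alpha$ if there is a finite $F'\supseteq F$ such that for every $q\in\mathrm{G}\langle F\mid p\rangle$, $\langle F'\mid q\rangle\in\mathfrak{R}_\beta$ for some $\beta<\alpha$; a type is ranked if it lies in some $\mathfrak{R}_\alpha$. For finite $F$, $\mathfrak{rc}(F)$ is $F$ together with the union of the typesets of the ranked types $\langle F\mid p\rangle$; for arbitrary $S$, $\mathfrak{rc}(S)=\bigcup\{\mathfrak{rc}(F)\mid F\text{ finite}\subseteq S\}$. -}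

module Defs where

open import Data.Nat using (ℕ)
open import Data.List using (List)
open import Data.List.Membership.Propositional using (_∈_)
open import Data.Product using (Σ; ∃; _×_; _,_)
open import Data.Sum using (_⊎_)
open import Function.Bundles using (_↔_; Inverse)
open import Function.Construct.Identity using (↔-id)
open import Function.Construct.Composition using (_↔-∘_)
open import Function.Construct.Symmetry using (↔-sym)
open import Relation.Binary.PropositionalEquality using (_≡_)

-- The symmetric group 𝔖(U): permutations of U are bijections U ↔ U,
-- acting by their forward map.
_·_ : {U : Set} → U ↔ U → U → U
g · x = Inverse.to g x

CountablyInfinite : Set → Set
CountablyInfinite U = U ↔ ℕ

record Subgroup (U : Set) : Set₁ where
  field
    _∈G : U ↔ U → Set
    ∈G-ext : ∀ {g h : U ↔ U} → (∀ x → g · x ≡ h · x) → g ∈G → h ∈G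
    id∈G : ↔-id U ∈G
    ∘∈G : ∀ {g h : U ↔ U} → g ∈G → h ∈G → (g ↔-∘ h) ∈G
    inv∈G : ∀ {g : U ↔ U} → g ∈G → ↔-sym g ∈G

module _ {U : Set} (G : Subgroup U) where
  open Subgroup G

  -- g ∈ G⟨F⟩ : pointwise stabiliser of the finite set F (a list)
  Stab : List U → U ↔ U → Set
  Stab F g = g ∈G × (∀ x → x ∈ F → g · x ≡ x)

  -- typeset G⟨F | p⟩ = { g p | g ∈ G⟨F⟩ } (the G⟨F⟩-orbit of p)
  TypeSet : List U → U → U → Set
  TypeSet F p q = Σ (U ↔ U) λ g → Stab F g × g · p ≡ q

  Finite : (U → Set) → Set
  Finite A = Σ (List U) λ L → ∀ x → A x → x ∈ L

  -- 𝔞𝔠(F) for finite F: union of the finite G⟨F⟩-orbits,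
  -- i.e. the points whose own G⟨F⟩-orbit is finite
  acF : List U → U → Set
  acF F y = Finite (TypeSet F y)

  ac : (U → Set) → U → Set
  ac S y = Σ (List U) λ F → (∀ x → x ∈ F → S x) × acF F y

  AlgebraicallyFinite : Set
  AlgebraicallyFinite = ∀ (F : List U) → Finite (acF F)

  -- Ranked types ⟨F | p⟩: the union over all ordinals α of 𝔑_α,
  -- i.e. the least class containing 𝔑₀ and closed under the rank step.
  data Ranked : List U → U → Set where
    rank0 : ∀ {F p} → Finite (TypeSet F p) → Ranked F p
    rankStep : ∀ {F p} (F′ : List U) → (∀ x → x ∈ F → x ∈ F′) →
               (∀ q → TypeSet F p q → Ranked F′ q) → Ranked F p

  rcF : List U → U → Set
  rcF F y = y ∈ F ⊎ Σ U λ p → Ranked F p × TypeSet F p y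

  rc : (U → Set) → U → Set
  rc S y = Σ (List U) λ F → (∀ x → x ∈ F → S x) × rcF F y

-- A ranked type has a finite typeset: by induction on the rank, every point of
-- the typeset of a rank-step type has finite G⟨F′⟩-orbit, so lies in the finite
-- set 𝔞𝔠(F′). Since typesets are orbits, a finite typeset makes each of its
-- points algebraic over F, giving 𝔯𝔠(F) ⊆ 𝔞𝔠(F); conversely every algebraic
-- point y is witnessed by the rank-0 type ⟨F | y⟩.
module Submission where

open import Defs
open import Data.Product using (_×_; _,_)
open import Data.Sum using (inj₁; inj₂)
open import Data.List using ([_])
open import Data.List.Membership.Propositional using (_∈_)
open import Data.List.Relation.Unary.Any using (here)
open import Function.Construct.Identity using (↔-id)
open import Function.Construct.Composition using (_↔-∘_)
open import Relation.Binary.PropositionalEquality using (refl; sym; trans; cong)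

module _ {U : Set} (G : Subgroup U) where
  open Subgroup G

  id-Stab : ∀ F → Stab G F (↔-id U)
  id-Stab F = id∈G , λ _ _ → refl

  ∘-Stab : ∀ {F g h} → Stab G F h → Stab G F g → Stab G F (h ↔-∘ g)
  ∘-Stab {h = h} (hG , hF) (gG , gF) =
    ∘∈G hG gG , λ x x∈F → trans (cong (h ·_) (gF x x∈F)) (hF x x∈F)

  TypeSet-refl : ∀ F p → TypeSet G F p p
  TypeSet-refl F p = ↔-id U , id-Stab F , refl

  TypeSet-trans : ∀ {F p q r} → TypeSet G F p q → TypeSet G F q r → TypeSet G F p r
  TypeSet-trans (g , gF , gp≡q) (h , hF , hq≡r) =
    h ↔-∘ g , ∘-Stab hF gF , trans (cong (h ·_) gp≡q) hq≡r

  TypeSet-∈-singleton : ∀ {F p q} → p ∈ F → TypeSet G F p q → q ∈ [ p ]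
  TypeSet-∈-singleton p∈F (g , (_ , gF) , gp≡q) = here (trans (sym gp≡q) (gF _ p∈F))

  Finite-⊆ : ∀ {A B : U → Set} → (∀ x → A x → B x) → Finite G B → Finite G A
  Finite-⊆ A⊆B (L , B⊆L) = L , λ x Ax → B⊆L x (A⊆B x Ax)

  acF⇒rcF : ∀ {F y} → acF G F y → rcF G F y
  acF⇒rcF {F} {y} fin = inj₂ (y , rank0 fin , TypeSet-refl F y)

  ac⇒rc : ∀ {S y} → ac G S y → rc G S y
  ac⇒rc (F , F⊆S , y∈acF) = F , F⊆S , acF⇒rcF y∈acF

  module _ (algFin : AlgebraicallyFinite G) where

    Ranked⇒Finite-TypeSet : ∀ {F p} → Ranked G F p → Finite G (TypeSet G F p)
    Ranked⇒Finite-TypeSet (rank0 fin) = fin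
    Ranked⇒Finite-TypeSet (rankStep F′ _ ranked) =
      Finite-⊆ (λ q q∈ → Ranked⇒Finite-TypeSet (ranked q q∈)) (algFin F′)

    rcF⇒acF : ∀ {F y} → rcF G F y → acF G F y
    rcF⇒acF (inj₁ y∈F) = _ , λ _ → TypeSet-∈-singleton y∈F
    rcF⇒acF (inj₂ (p , ranked , p~y)) =
      Finite-⊆ (λ _ → TypeSet-trans p~y) (Ranked⇒Finite-TypeSet ranked)

    rc⇒ac : ∀ {S y} → rc G S y → ac G S y
    rc⇒ac (F , F⊆S , y∈rcF) = F , F⊆S , rcF⇒acF y∈rcF

lemma8p5 : (U : Set) → CountablyInfinite U → (G : Subgroup U) →
             AlgebraicallyFinite G → (S : U → Set) →
             (∀ y → rc G S y → ac G S y) × (∀ y → ac G S y → rc G S y)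
lemma8p5 U _ G algFin S = (λ _ → rc⇒ac G algFin) , (λ _ → ac⇒rc G)
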